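{- Let $B$ be a set of cells of an $m\times n$ array having exactly $h$ cells in each row and exactly $k$ cells in each column. Let $G$ be a finite group of order $v$ and $J$ a subgroup of order $t$, and let $\lambda$ be a positive integer such that $nk=mh$, $v=\frac{2nk}{\lambda}+t$, $t\mid v$, and if $G\setminus J$ contains an involution then $\lambda$ is even. Suppose that $B$ can be partitioned into nice tiles $T_1,\dots,T_\ell$ and that $v-t\ge\max_i |T_i|$. Then there exists a ${}^\lambda\mathrm{NH}_t(m,n;h,k)$ over $G$ relative to $J$.
   Context: Groups are written additively (not necessarily abelian). Cells of an $m\times n$ array are pairs $(i,j)$, $i\in\{1,\dots,m\}$, $j\in\{1,\dots,n\}$, with row indices taken modulo $m$ and column indices modulo $n$. A partially filled (p.f.) array over $G$ is an array whose cells are empty or contain elements of $G$; $skel(A)$ is its set of filled cells. A set $T$ of cells of an $m\times n$ array is a nice tile if for every group $G$, every subset $S\subseteq G$ with $|S|=|T|$, and all vectors $(r_1,\dots,r_m)\in G^m$, $(c_1,\dots,c_n)\in G^n$, there is a p.f. array $A$ with $skel(A)=T$ whose entries are exactly the elements of $S$, each used once, such that: for every row $i$ meeting $T$, with $h_i$ the number of cells of $T$ in row $i$, there is $\beta_i$ with the cells of $T$ in row $i$ equal to $(i,\beta_i),(i,\beta_i+1),\dots,(i,\beta_i+h_i-1)$, and the sum of the entries of row $i$ taken in this order is different from $r_i$; and for every column $j$ meeting $T$, with $k_j$ the number of cells of $T$ in column $j$, there is $\gamma_j$ with the cells of $T$ in column $j$ equal to $(\gamma_j,j),(\gamma_j+1,j),\dots,(\gamma_j+k_j-1,j)$,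 and the sum of the entries of column $j$ taken in this order is different from $c_j$. A ${}^\lambda\mathrm{NH}_t(m,n;h,k)$ over $G$ relative to $J$ is an $m\times n$ p.f. array over $G$ with exactly $h$ filled cells per row and $k$ per column, such that the multiset obtained by taking, for every filled cell with entry $x$, both $x$ and $-x$ (with multiplicity) is exactly each element of $G\setminus J$ with multiplicity $\lambda$, and such that every row sum (left to right) and column sum (top to bottom) is nonzero. -}

module Defs where

open import Level using (0ℓ)
open import Data.Nat using (ℕ; zero; suc; _+_; _*_; _∸_; _≤_; _<_; s≤s; _<?_)
open import Data.Nat.Divisibility using (_∣_)
open import Data.Bool using (Bool; true; false; not; if_then_else_; T)
open import Data.Fin using (Fin; toℕ; fromℕ<) renaming (zero to fzero)
open import Data.Maybe using (Maybe; just; nothing; is-just; maybe′)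
open import Data.Nat.ListAction using (sum)
open import Data.List using (List; []; _∷_; map; length; foldr; allFin; mapMaybe; concatMap; concat; replicate; filterᵇ; upTo)
open import Data.List.Relation.Binary.Permutation.Propositional using (_↭_)
open import Data.List.Relation.Unary.Unique.Propositional using (Unique)
open import Data.Product using (Σ; _×_; ∃; ∃-syntax; _,_)
open import Function using (_∘_; id)
open import Function.Bundles using (_↔_; _⇔_; Inverse)
open import Relation.Binary.PropositionalEquality using (_≡_; _≢_)
open import Relation.Nullary using (yes; no; ¬_)
open import Algebra.Structures using (IsGroup)

-- Groups (written additively in the paper): a group structure on a type,
-- with propositional equality as the equality of the group.

record PGroup : Set₁ where
  infixl 6 _∙_
  field
    Carrier : Set
    _∙_     : Carrier → Carrier → Carrier
    ε       : Carrier
    _⁻¹     : Carrier → Carrier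
    isGroup : IsGroup {A = Carrier} _≡_ _∙_ ε _⁻¹

Cells : ℕ → ℕ → Set
Cells m n = Fin m → Fin n → Bool

PFArray : ℕ → ℕ → Set → Set
PFArray m n A = Fin m → Fin n → Maybe A

skel : ∀ {m n A} → PFArray m n A → Cells m n
skel F i j = is-just (F i j)

b2n : Bool → ℕ
b2n b = if b then 1 else 0

rowCount : ∀ {m n} → Cells m n → Fin m → ℕ
rowCount {n = n} T i = sum (map (λ j → b2n (T i j)) (allFin n))

colCount : ∀ {m n} → Cells m n → Fin n → ℕ
colCount {m = m} T j = sum (map (λ i → b2n (T i j)) (allFin m))

size : ∀ {m n} → Cells m n → ℕ
size {m = m} T = sum (map (rowCount T) (allFin m))

entries : ∀ {m n A} → PFArray m n A → List A
entries {m} {n} F = concatMap (λ i → mapMaybe (F i) (allFin n)) (allFin m)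

rowEntries : ∀ {m n A} → PFArray m n A → Fin m → List A
rowEntries {n = n} F i = mapMaybe (F i) (allFin n)

colEntries : ∀ {m n A} → PFArray m n A → Fin n → List A
colEntries {m = m} F j = mapMaybe (λ i → F i j) (allFin m)

next : ∀ {n} → Fin n → Fin n
next {suc n} i with toℕ i <? n
... | yes p = fromℕ< (s≤s p)
... | no _  = fzero

cyc : ∀ {n} → Fin n → ℕ → Fin n
cyc β zero    = β
cyc β (suc s) = next (cyc β s)

module _ (G : PGroup) where
  open PGroup G

  gsum : List Carrier → Carrier
  gsum = foldr _∙_ ε

  val : Maybe Carrier → Carrier
  val = maybe′ id ε

RowConsecutive : ∀ {m n} → Cells m n → Fin m → Fin n → Set
RowConsecutive T i β =
  ∀ j → T i j ≡ true ⇔ (∃[ s ] (s < rowCount T i × j ≡ cyc β s))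

ColConsecutive : ∀ {m n} → Cells m n → Fin n → Fin m → Set
ColConsecutive T j γ =
  ∀ i → T i j ≡ true ⇔ (∃[ s ] (s < colCount T j × i ≡ cyc γ s))

NiceTile : ∀ {m n} → Cells m n → Set₁
NiceTile {m} {n} T =
  (G : PGroup) → let open PGroup G in
  (S : List Carrier) → Unique S → length S ≡ size T →
  (r : Fin m → Carrier) (c : Fin n → Carrier) →
  Σ (PFArray m n Carrier) λ F →
      (∀ i j → skel F i j ≡ T i j)
    × (entries F ↭ S)
    × (∀ i → (∃[ j ] T i j ≡ true) →
         ∃[ β ] (RowConsecutive T i β
                 × gsum G (map (λ s → val G (F i (cyc β s))) (upTo (rowCount T i))) ≢ r i))
    × (∀ j → (∃[ i ] T i j ≡ true) →
         ∃[ γ ] (ColConsecutive T j γ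
                 × gsum G (map (λ s → val G (F (cyc γ s) j)) (upTo (colCount T j))) ≢ c j))

module _ (G : PGroup) where
  open PGroup G

  record IsSubgroup (J : Carrier → Bool) : Set where
    field
      ε∈    : J ε ≡ true
      ∙∈    : ∀ {x y} → J x ≡ true → J y ≡ true → J (x ∙ y) ≡ true
      ⁻¹∈   : ∀ {x} → J x ≡ true → J (x ⁻¹) ≡ true

  HasInvolutionOutside : (J : Carrier → Bool) → Set
  HasInvolutionOutside J = ∃[ x ] (J x ≡ false × x ≢ ε × x ∙ x ≡ ε)

  outsideList : ∀ {v} → Carrier ↔ Fin v → (Carrier → Bool) → List Carrier
  outsideList {v} e J = filterᵇ (not ∘ J) (map (Inverse.from e) (allFin v))

  IsNH : ∀ {v} → Carrier ↔ Fin v → (J : Carrier → Bool) →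
         (λ' m n h k : ℕ) → PFArray m n Carrier → Set
  IsNH e J λ' m n h k F =
      (∀ i → rowCount (skel F) i ≡ h)
    × (∀ j → colCount (skel F) j ≡ k)
    -- the multiset {x, −x : x an entry} is λ copies of G \ J
    × (concatMap (λ x → x ∷ (x ⁻¹) ∷ []) (entries F)
         ↭ concat (replicate λ' (outsideList e J)))
    × (∀ i → gsum G (rowEntries F i) ≢ ε)
    × (∀ j → gsum G (colEntries F j) ≢ ε)

-- The tiles are filled one after another with consecutive stretches of a
-- sequence running periodically through G \ J; a stretch of at most
-- v − t = |G \ J| terms has no repetitions, so it is a legal set of entries
-- for a nice tile.  A row sum is secured by the last tile placed in the row,
-- when all other cells of the row are already filled.  In a group a sequence
-- sums to zero iff each of its cyclic rotations does (xy = 0 ⇒ yx = 0), so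
-- reading the row from the first cell β of its block of T, the row sum
-- vanishes iff the block sum equals minus the sum of the other cells read
-- from β + h.  Where the block starts is determined by the shape of T alone,
-- so this value can be handed to the nice tile as the row sum to avoid;
-- columns are treated alike.
--
-- The nk = λ|G \ J|/2 entries are the first nk terms of the sequence.  For
-- even λ the period is any enumeration of G \ J.  For odd λ there is no
-- involution in G \ J, which therefore splits as Φ ∪ −Φ; with period Φ
-- followed by −Φ the last, incomplete period is exactly Φ, and Φ together
-- with −Φ is once more G \ J.

module Submission where

open import Defs
open import Data.Nat using (ℕ; _*_; _+_; _∸_; _≤_)
open import Data.Nat.Divisibility using (_∣_)
open import Data.Bool using (Bool; true)
open import Data.Fin using (Fin)
open import Data.Product using (Σ; _×_; ∃-syntax)
open import Function.Bundles using (_↔_)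
open import Relation.Binary.PropositionalEquality using (_≡_)

open import Data.Nat using (zero; suc; _<_; s≤s; z≤n; _<?_; NonZero; _<ᵇ_)
open import Data.Nat.Properties hiding (_≟_; suc-injective)
open import Data.Nat.DivMod
open import Data.Nat.Divisibility using (n∣m⇒m%n≡0)
open import Data.Nat.ListAction using (sum)
open import Data.Nat.Tactic.RingSolver using (solve-∀)
open import Algebra.Properties.CommutativeSemigroup +-commutativeSemigroup using (interchange)
open import Data.Bool using (false; not; _∨_; _≟_)
open import Data.Bool.Properties using (T-≡; T-not-≡; ∨-zeroʳ)
open import Data.Empty using (⊥; ⊥-elim)
open import Data.Fin using (toℕ) renaming (zero to fzero; suc to fsuc)
open import Data.Fin.Properties using (toℕ<n; toℕ-fromℕ<; toℕ-injective; suc-injective; any?)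
open import Data.List
  using (List; []; _∷_; _++_; map; length; allFin; upTo; applyUpTo; tabulate; mapMaybe; concatMap; concat;
         replicate; filterᵇ)
open import Data.List.Properties
  using (length-map; length-tabulate; length-applyUpTo; length-++; map-tabulate; map-applyUpTo; map-cong; applyUpTo-∷ʳ;
         mapMaybe-cong; mapMaybe-nothing; concatMap-++; ++-identityʳ; ++-assoc)
open import Data.List.Membership.Propositional using (_∈_)
open import Data.List.Membership.Propositional.Properties
  using (∈-map⁺; ∈-map⁻; ∈-allFin; ∈-filter⁺; ∈-filter⁻; ∈-++⁺ˡ; ∈-++⁺ʳ; ∈-++⁻)
open import Data.List.Membership.Propositional.Properties.WithK using (unique∧set⇒bag)
open import Data.List.Relation.Binary.BagAndSetEquality using (∼bag⇒↭)
open import Data.List.Relation.Binary.Permutation.Propositional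
  using (_↭_; ↭-refl; ↭-prep; ↭-trans; ↭-sym; ↭-reflexive; module PermutationReasoning)
import Data.List.Relation.Binary.Permutation.Propositional as ↭
open import Data.List.Relation.Binary.Permutation.Propositional.Properties
  using (↭-length; shift; shifts; ++⁺; ++⁺ˡ; ++-comm)
import Data.List.Relation.Binary.Permutation.Propositional.Properties as ↭ₚ
open import Data.List.Relation.Unary.Any using (here; there)
import Data.List.Relation.Unary.All as All
open import Data.List.Relation.Unary.AllPairs.Core using ([]; _∷_)
open import Data.List.Relation.Unary.Unique.Propositional using (Unique)
import Data.List.Relation.Unary.Unique.Propositional.Properties as Unique
open import Data.Maybe using (Maybe; just; nothing; is-just; _<∣>_)
open import Data.Maybe.Properties using (<∣>-identityʳ)
open import Data.Product using (_,_; proj₁; proj₂)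
open import Data.Sum using (inj₁; inj₂)
open import Function using (id; _∘_)
open import Function.Bundles using (_⇔_; Equivalence; Inverse; mk⇔)
open import Algebra.Bundles using (Group)
open import Axiom.UniquenessOfIdentityProofs.WithK using (uip)
open import Algebra.Structures using (IsGroup)
open import Relation.Binary.Definitions using (tri<; tri≈; tri>)
open import Relation.Binary.PropositionalEquality
  using (refl; sym; trans; cong; cong₂; subst; subst₂; _≢_; module ≡-Reasoning)
open import Relation.Nullary using (Dec; yes; no; ¬_)
open import Relation.Nullary.Decidable using (_×-dec_; T?)

-- Cyclic indices

[1+m%n]%n≡[1+m]%n : ∀ m n .{{_ : NonZero n}} → suc (m % n) % n ≡ suc m % n
[1+m%n]%n≡[1+m]%n m n = begin
  suc (m % n) % n          ≡⟨ %-distribˡ-+ 1 (m % n) n ⟩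
  (1 % n + m % n % n) % n  ≡⟨ cong (λ z → (1 % n + z) % n) (m%n%n≡m%n m n) ⟩
  (1 % n + m % n) % n      ≡⟨ %-distribˡ-+ 1 m n ⟨
  suc m % n                ∎
  where open ≡-Reasoning

%-injective-on-window : ∀ w .{{_ : NonZero w}} {x y} → x < y → y < x + w → x % w ≢ y % w
%-injective-on-window w {x} {y} x<y y<x+w x%w≡y%w = <⇒≱ y<x+w x+w≤y
  where
  open ≤-Reasoning
  x/w<y/w : x / w < y / w
  x/w<y/w = *-cancelʳ-< w (x / w) (y / w) (+-cancelˡ-< (x % w) _ _ (begin-strict
    x % w + x / w * w  ≡⟨ m≡m%n+[m/n]*n x w ⟨
    x                  <⟨ x<y ⟩
    y                  ≡⟨ m≡m%n+[m/n]*n y w ⟩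
    y % w + y / w * w  ≡⟨ cong (_+ y / w * w) x%w≡y%w ⟨
    x % w + y / w * w  ∎))
  x+w≤y : x + w ≤ y
  x+w≤y = begin
    x + w                    ≡⟨ cong (_+ w) (m≡m%n+[m/n]*n x w) ⟩
    x % w + x / w * w + w    ≡⟨ +-assoc (x % w) (x / w * w) w ⟩
    x % w + (x / w * w + w)  ≡⟨ cong (x % w +_) (+-comm (x / w * w) w) ⟩
    x % w + suc (x / w) * w  ≤⟨ +-monoʳ-≤ (x % w) (*-monoˡ-≤ w x/w<y/w) ⟩
    x % w + y / w * w        ≡⟨ cong (_+ y / w * w) x%w≡y%w ⟩
    y % w + y / w * w        ≡⟨ m≡m%n+[m/n]*n y w ⟨
    y                        ∎

toℕ-next : ∀ {n} (i : Fin (suc n)) → toℕ (next i) ≡ suc (toℕ i) % suc n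
toℕ-next {n} i with toℕ i <? n
... | yes i<n = trans (toℕ-fromℕ< (s≤s i<n)) (sym (m<n⇒m%n≡m (s≤s i<n)))
... | no i≮n = sym (trans (cong (λ z → suc z % suc n) i≡n) (n%n≡0 (suc n)))
  where
  i≡n : toℕ i ≡ n
  i≡n = ≤-antisym (≤-pred (toℕ<n i)) (≮⇒≥ i≮n)

toℕ-cyc : ∀ {n} (β : Fin (suc n)) s → toℕ (cyc β s) ≡ (toℕ β + s) % suc n
toℕ-cyc {n} β zero = begin
  toℕ β              ≡⟨ m<n⇒m%n≡m (toℕ<n β) ⟨
  toℕ β % suc n      ≡⟨ cong (_% suc n) (+-identityʳ (toℕ β)) ⟨
  (toℕ β + 0) % suc n ∎
  where open ≡-Reasoning
toℕ-cyc {n} β (suc s) = begin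
  toℕ (next (cyc β s))               ≡⟨ toℕ-next (cyc β s) ⟩
  suc (toℕ (cyc β s)) % suc n        ≡⟨ cong (λ z → suc z % suc n) (toℕ-cyc β s) ⟩
  suc ((toℕ β + s) % suc n) % suc n  ≡⟨ [1+m%n]%n≡[1+m]%n (toℕ β + s) (suc n) ⟩
  suc (toℕ β + s) % suc n            ≡⟨ cong (_% suc n) (+-suc (toℕ β) s) ⟨
  (toℕ β + suc s) % suc n            ∎
  where open ≡-Reasoning

cyc-next : ∀ {n} (β : Fin n) s → cyc (next β) s ≡ cyc β (suc s)
cyc-next β zero    = refl
cyc-next β (suc s) = cong next (cyc-next β s)

cyc-period : ∀ {n} (β : Fin (suc n)) → cyc β (suc n) ≡ β
cyc-period {n} β = toℕ-injective (begin
  toℕ (cyc β (suc n))      ≡⟨ toℕ-cyc β (suc n) ⟩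
  (toℕ β + suc n) % suc n  ≡⟨ [m+n]%n≡m%n (toℕ β) (suc n) ⟩
  toℕ β % suc n            ≡⟨ m<n⇒m%n≡m (toℕ<n β) ⟩
  toℕ β                    ∎)
  where open ≡-Reasoning

next-injective : ∀ {n} (i i' : Fin (suc n)) → next i ≡ next i' → i ≡ i'
next-injective {n} i i' eq = begin
  i                 ≡⟨ cyc-period i ⟨
  cyc i (suc n)     ≡⟨ cyc-next i n ⟨
  cyc (next i) n    ≡⟨ cong (λ j → cyc j n) eq ⟩
  cyc (next i') n   ≡⟨ cyc-next i' n ⟩
  cyc i' (suc n)    ≡⟨ cyc-period i' ⟩
  i'                ∎
  where open ≡-Reasoning

cyc-distinct : ∀ {n} (β : Fin (suc n)) {s s'} → s < s' → s' < suc n → cyc β s ≢ cyc β s'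
cyc-distinct {n} β {s} {s'} s<s' s'<N eq =
  %-injective-on-window (suc n) (+-monoʳ-< (toℕ β) s<s')
    (<-≤-trans (+-monoʳ-< (toℕ β) s'<N) (+-monoˡ-≤ (suc n) (m≤m+n (toℕ β) s)))
    (trans (sym (toℕ-cyc β s)) (trans (cong toℕ eq) (toℕ-cyc β s')))

cyc-injective : ∀ {n} (β : Fin (suc n)) {s s'} → s < suc n → s' < suc n → cyc β s ≡ cyc β s' → s ≡ s'
cyc-injective β {s} {s'} s<N s'<N eq with <-cmp s s'
... | tri< s<s' _ _ = ⊥-elim (cyc-distinct β s<s' s'<N eq)
... | tri≈ _ s≡s' _ = s≡s'
... | tri> _ _ s'<s = ⊥-elim (cyc-distinct β s'<s s<N (sym eq))

cyc-zero-toℕ : ∀ {n} (β : Fin (suc n)) → cyc fzero (toℕ β) ≡ β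
cyc-zero-toℕ β = toℕ-injective (trans (toℕ-cyc fzero (toℕ β)) (m<n⇒m%n≡m (toℕ<n β)))

cyc-zero-suc : ∀ n s → s < suc n → cyc {suc (suc n)} fzero (suc s) ≡ fsuc (cyc {suc n} fzero s)
cyc-zero-suc n s s<N = toℕ-injective (begin
  toℕ (cyc fzero (suc s))  ≡⟨ toℕ-cyc fzero (suc s) ⟩
  suc s % suc (suc n)      ≡⟨ m<n⇒m%n≡m (s≤s s<N) ⟩
  suc s                    ≡⟨ cong suc (trans (toℕ-cyc fzero s) (m<n⇒m%n≡m s<N)) ⟨
  suc (toℕ (cyc fzero s))  ∎)
  where open ≡-Reasoning

module _ {A : Set} where

  applyUpTo-cong : ∀ {f g : ℕ → A} n → (∀ i → i < n → f i ≡ g i) → applyUpTo f n ≡ applyUpTo g n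
  applyUpTo-cong zero    f≗g = refl
  applyUpTo-cong (suc n) f≗g =
    cong₂ _∷_ (f≗g 0 (s≤s z≤n)) (applyUpTo-cong n (λ i i<n → f≗g (suc i) (s≤s i<n)))

  applyUpTo-+ : ∀ (f : ℕ → A) a b → applyUpTo f (a + b) ≡ applyUpTo f a ++ applyUpTo (λ i → f (a + i)) b
  applyUpTo-+ f zero    b = refl
  applyUpTo-+ f (suc a) b = cong (f 0 ∷_) (applyUpTo-+ (f ∘ suc) a b)

  applyUpTo-cyc-zero : ∀ n (g : Fin (suc n) → A) → applyUpTo (g ∘ cyc fzero) (suc n) ≡ tabulate g
  applyUpTo-cyc-zero zero    g = refl
  applyUpTo-cyc-zero (suc n) g = cong (g fzero ∷_) (trans
    (applyUpTo-cong (suc n) (λ s s<N → cong g (cyc-zero-suc n s s<N)))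
    (applyUpTo-cyc-zero n (g ∘ fsuc)))

  window : (ℕ → A) → ℕ → ℕ → List A
  window f a b = applyUpTo (λ i → f (a + i)) b

  window-+ : ∀ (f : ℕ → A) a b c → window f a (b + c) ≡ window f a b ++ window f (a + b) c
  window-+ f a b c = trans (applyUpTo-+ (λ i → f (a + i)) b c)
    (cong (window f a b ++_) (applyUpTo-cong c (λ i _ → cong f (sym (+-assoc a b i)))))

module _ {X Y : Set} where

  concatMap⁺ : ∀ (f : X → List Y) {xs ys} → xs ↭ ys → concatMap f xs ↭ concatMap f ys
  concatMap⁺ f ↭.refl           = ↭-refl
  concatMap⁺ f (↭.prep x p)     = ++⁺ˡ (f x) (concatMap⁺ f p)
  concatMap⁺ f (↭.swap x y p)   = ↭-trans (++⁺ˡ (f x) (++⁺ˡ (f y) (concatMap⁺ f p))) (shifts (f x) (f y))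
  concatMap⁺ f (↭.trans p q)    = ↭-trans (concatMap⁺ f p) (concatMap⁺ f q)

  concatMap-↭-++ : ∀ (f g h : X → List Y) xs → (∀ x → f x ↭ g x ++ h x) →
                   concatMap f xs ↭ concatMap g xs ++ concatMap h xs
  concatMap-↭-++ f g h []       f↭g++h = ↭-refl
  concatMap-↭-++ f g h (x ∷ xs) f↭g++h = begin
    f x ++ concatMap f xs          ↭⟨ ++⁺ (f↭g++h x) (concatMap-↭-++ f g h xs f↭g++h) ⟩
    (g x ++ h x) ++ (gs ++ hs)     ↭⟨ ↭ₚ.++-assoc (g x) (h x) (gs ++ hs) ⟩
    g x ++ (h x ++ (gs ++ hs))     ↭⟨ ++⁺ˡ (g x) (shifts (h x) gs) ⟩
    g x ++ (gs ++ (h x ++ hs))     ↭⟨ ↭ₚ.++-assoc (g x) gs (h x ++ hs) ⟨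
    (g x ++ gs) ++ (h x ++ hs)     ∎
    where
    open PermutationReasoning
    gs hs : List Y
    gs = concatMap g xs
    hs = concatMap h xs

  mapMaybe-<∣> : ∀ (f g : X → Maybe Y) xs → (∀ x → is-just (f x) ≡ true → g x ≡ nothing) →
                 mapMaybe (λ x → f x <∣> g x) xs ↭ mapMaybe f xs ++ mapMaybe g xs
  mapMaybe-<∣> f g []       disjoint = ↭-refl
  mapMaybe-<∣> f g (x ∷ xs) disjoint with f x | g x | disjoint x
  ... | just a  | just b  | f∩g with () ← f∩g refl
  ... | just a  | nothing | _ = ↭-prep a (mapMaybe-<∣> f g xs disjoint)
  ... | nothing | just b  | _ =
    ↭-trans (↭-prep b (mapMaybe-<∣> f g xs disjoint)) (↭-sym (shift b (mapMaybe f xs) (mapMaybe g xs)))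
  ... | nothing | nothing | _ = mapMaybe-<∣> f g xs disjoint

module _ {A : Set} where

  unique-sameMembers⇒↭ : ∀ {xs ys : List A} → Unique xs → Unique ys → (∀ z → z ∈ xs ⇔ z ∈ ys) → xs ↭ ys
  unique-sameMembers⇒↭ unique-xs unique-ys same =
    ∼bag⇒↭ (unique∧set⇒bag unique-xs unique-ys (λ {z} → same z))

  length-filterᵇ+length-filterᵇ-not : ∀ (p : A → Bool) xs →
    length (filterᵇ p xs) + length (filterᵇ (not ∘ p) xs) ≡ length xs
  length-filterᵇ+length-filterᵇ-not p []       = refl
  length-filterᵇ+length-filterᵇ-not p (x ∷ xs) with p x
  ... | true  = cong suc (length-filterᵇ+length-filterᵇ-not p xs)
  ... | false = trans (+-suc _ _) (cong suc (length-filterᵇ+length-filterᵇ-not p xs))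

  concat-replicate-+ : ∀ (xs : List A) a b →
                       concat (replicate (a + b) xs) ≡ concat (replicate a xs) ++ concat (replicate b xs)
  concat-replicate-+ xs zero    b = refl
  concat-replicate-+ xs (suc a) b = trans (cong (xs ++_) (concat-replicate-+ xs a b)) (sym (++-assoc xs _ _))

  concat-replicate-*2 : ∀ (xs : List A) q → concat (replicate (q * 2) xs) ≡ concat (replicate q (xs ++ xs))
  concat-replicate-*2 xs zero    = refl
  concat-replicate-*2 xs (suc q) =
    trans (cong (λ ys → xs ++ xs ++ ys) (concat-replicate-*2 xs q)) (sym (++-assoc xs xs _))

  length≡0⇒[] : ∀ (xs : List A) → length xs ≡ 0 → xs ≡ []
  length≡0⇒[] [] _ = refl

  concat-replicate-[] : ∀ q → concat (replicate q ([] {A = A})) ≡ []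
  concat-replicate-[] zero    = refl
  concat-replicate-[] (suc q) = concat-replicate-[] q

is-just-<∣> : ∀ {A : Set} (x y : Maybe A) → is-just (x <∣> y) ≡ (is-just x ∨ is-just y)
is-just-<∣> (just _) y = refl
is-just-<∣> nothing  y = refl

is-just≡false⇒nothing : ∀ {A : Set} (x : Maybe A) → is-just x ≡ false → x ≡ nothing
is-just≡false⇒nothing nothing _ = refl

true≢false : true ≢ false
true≢false ()

≢true⇒≡false : ∀ {b} → b ≢ true → b ≡ false
≢true⇒≡false {false} _   = refl
≢true⇒≡false {true}  b≢t = ⊥-elim (b≢t refl)

-- Sets of cells

count : ∀ {n} → (Fin n → Bool) → ℕ
count {n} t = sum (map (λ j → b2n (t j)) (allFin n))

sum-b2n-≤-length : ∀ {A : Set} (f : A → Bool) xs → sum (map (λ x → b2n (f x)) xs) ≤ length xs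
sum-b2n-≤-length f []       = z≤n
sum-b2n-≤-length f (x ∷ xs) with f x
... | true  = s≤s (sum-b2n-≤-length f xs)
... | false = m≤n⇒m≤1+n (sum-b2n-≤-length f xs)

count-≤ : ∀ {n} (t : Fin n → Bool) → count t ≤ n
count-≤ {n} t = subst (count t ≤_) (length-tabulate id) (sum-b2n-≤-length t (allFin n))

sum-map-const : ∀ {A : Set} (c : ℕ) (xs : List A) → sum (map (λ _ → c) xs) ≡ length xs * c
sum-map-const c []       = refl
sum-map-const c (x ∷ xs) = cong (c +_) (sum-map-const c xs)

sum-map-cong : ∀ {A : Set} {f g : A → ℕ} xs → (∀ x → f x ≡ g x) → sum (map f xs) ≡ sum (map g xs)
sum-map-cong xs f≗g = cong sum (map-cong f≗g xs)

sum-map-+ : ∀ {A : Set} (f g : A → ℕ) xs → sum (map (λ x → f x + g x) xs) ≡ sum (map f xs) + sum (map g xs)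
sum-map-+ f g []       = refl
sum-map-+ f g (x ∷ xs) rewrite sum-map-+ f g xs = interchange (f x) (g x) (sum (map f xs)) (sum (map g xs))

count≥1⇒∃ : ∀ {n} (t : Fin n → Bool) → 1 ≤ count t → ∃[ j ] t j ≡ true
count≥1⇒∃ {n} t 1≤count with any? (λ j → t j ≟ true)
... | yes found = found
... | no none = ⊥-elim (<⇒≢ 1≤count (sym (sum-map-zero (allFin n))))
  where
  sum-map-zero : ∀ js → sum (map (λ j → b2n (t j)) js) ≡ 0
  sum-map-zero []       = refl
  sum-map-zero (j ∷ js) rewrite ≢true⇒≡false {t j} (λ tj → none (j , tj)) = sum-map-zero js

-- rowCount T i and RowConsecutive T i are count and Consecutive of the row T i;
-- likewise for columns.
Consecutive : ∀ {k} → (Fin k → Bool) → Fin k → Set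
Consecutive t β = ∀ j → t j ≡ true ⇔ (∃[ s ] (s < count t × j ≡ cyc β s))

module _ {m n : ℕ} where

  _∪_ : Cells m n → Cells m n → Cells m n
  (X ∪ Y) i j = X i j ∨ Y i j

  Disjoint : Cells m n → Cells m n → Set
  Disjoint X Y = ∀ i j → X i j ≡ true → Y i j ≡ false

  size-cong : (X Y : Cells m n) → (∀ i j → X i j ≡ Y i j) → size X ≡ size Y
  size-cong X Y X≗Y = sum-map-cong (allFin m) (λ i → sum-map-cong (allFin n) (λ j → cong b2n (X≗Y i j)))

  size-∪ : (X Y : Cells m n) → Disjoint X Y → size (X ∪ Y) ≡ size X + size Y
  size-∪ X Y X∩Y=∅ = trans
    (sum-map-cong (allFin m) (λ i → trans
      (sum-map-cong (allFin n) (λ j → b2n-∨ (X i j) (Y i j) (X∩Y=∅ i j)))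
      (sum-map-+ (λ j → b2n (X i j)) (λ j → b2n (Y i j)) (allFin n))))
    (sum-map-+ (rowCount X) (rowCount Y) (allFin m))
    where
    b2n-∨ : ∀ a b → (a ≡ true → b ≡ false) → b2n (a ∨ b) ≡ b2n a + b2n b
    b2n-∨ true  b a⇒¬b rewrite a⇒¬b refl = refl
    b2n-∨ false b a⇒¬b = refl

  size≡rows*h : (X : Cells m n) (h : ℕ) → (∀ i → rowCount X i ≡ h) → size X ≡ m * h
  size≡rows*h X h rowX = trans (sum-map-cong (allFin m) rowX)
    (trans (sum-map-const h (allFin m)) (cong (_* h) (length-tabulate {n = m} id)))

  ⋃ : ∀ {ℓ} → (Fin ℓ → Cells m n) → Cells m n
  ⋃ {zero}  T = λ _ _ → false
  ⋃ {suc ℓ} T = T fzero ∪ ⋃ (T ∘ fsuc)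

  totalSize : ∀ {ℓ} → (Fin ℓ → Cells m n) → ℕ
  totalSize {zero}  T = 0
  totalSize {suc ℓ} T = size (T fzero) + totalSize (T ∘ fsuc)

  PairwiseDisjoint : ∀ {ℓ} → (Fin ℓ → Cells m n) → Set
  PairwiseDisjoint T = ∀ r r' i j → T r i j ≡ true → T r' i j ≡ true → r ≡ r'

  ⋃⇒∃ : ∀ {ℓ} (T : Fin ℓ → Cells m n) i j → ⋃ T i j ≡ true → ∃[ r ] T r i j ≡ true
  ⋃⇒∃ {suc ℓ} T i j ∈⋃ with T fzero i j in eq
  ... | true  = fzero , eq
  ... | false with ⋃⇒∃ (T ∘ fsuc) i j ∈⋃
  ...   | r , ∈T = fsuc r , ∈T

  ∃⇒⋃ : ∀ {ℓ} (T : Fin ℓ → Cells m n) i j r → T r i j ≡ true → ⋃ T i j ≡ true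
  ∃⇒⋃ {suc ℓ} T i j fzero    ∈T rewrite ∈T = refl
  ∃⇒⋃ {suc ℓ} T i j (fsuc r) ∈T rewrite ∃⇒⋃ (T ∘ fsuc) i j r ∈T = ∨-zeroʳ (T fzero i j)

  PairwiseDisjoint-tail : ∀ {ℓ} (T : Fin (suc ℓ) → Cells m n) → PairwiseDisjoint T → PairwiseDisjoint (T ∘ fsuc)
  PairwiseDisjoint-tail T disj r r' i j ∈T ∈T' = suc-injective (disj (fsuc r) (fsuc r') i j ∈T ∈T')

  head-disjoint-⋃tail : ∀ {ℓ} (T : Fin (suc ℓ) → Cells m n) → PairwiseDisjoint T →
                        Disjoint (T fzero) (⋃ (T ∘ fsuc))
  head-disjoint-⋃tail T disj i j ∈T₀ = ≢true⇒≡false λ ∈⋃ → notInTail (⋃⇒∃ (T ∘ fsuc) i j ∈⋃)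
    where
    notInTail : ∃[ r ] T (fsuc r) i j ≡ true → ⊥
    notInTail (r , ∈T) with () ← disj fzero (fsuc r) i j ∈T₀ ∈T

  totalSize≡size-⋃ : ∀ {ℓ} (T : Fin ℓ → Cells m n) → PairwiseDisjoint T → totalSize T ≡ size (⋃ T)
  totalSize≡size-⋃ {zero}  T disj = sym (trans
    (size≡rows*h (⋃ T) 0 (λ i → trans (sum-map-const 0 (allFin n)) (*-zeroʳ (length (allFin n))))) (*-zeroʳ m))
  totalSize≡size-⋃ {suc ℓ} T disj = trans
    (cong (size (T fzero) +_) (totalSize≡size-⋃ (T ∘ fsuc) (PairwiseDisjoint-tail T disj)))
    (sym (size-∪ (T fzero) (⋃ (T ∘ fsuc)) (head-disjoint-⋃tail T disj)))

  ⋃≗ : ∀ {ℓ} (T : Fin ℓ → Cells m n) (B : Cells m n) →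
       (∀ i j → B i j ≡ true → ∃[ r ] T r i j ≡ true) → (∀ r i j → T r i j ≡ true → B i j ≡ true) →
       ∀ i j → ⋃ T i j ≡ B i j
  ⋃≗ T B cover inB i j with ⋃ T i j in ⋃eq | B i j in Beq
  ... | true  | true  = refl
  ... | false | false = refl
  ... | true  | false = ⊥-elim (true≢false (trans (sym (inB _ i j (proj₂ (⋃⇒∃ T i j ⋃eq)))) Beq))
  ... | false | true  = ⊥-elim (true≢false (trans (sym (∃⇒⋃ T i j _ (proj₂ (cover i j Beq)))) ⋃eq))

-- Line sums and the filling of the tiles

PrecedesBlock : ∀ {k} → (Fin k → Bool) → Fin k → Set
PrecedesBlock t j = t j ≡ false × t (next j) ≡ true

precedesBlock? : ∀ {k} (t : Fin k → Bool) j → Dec (PrecedesBlock t j)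
precedesBlock? t j = (t j ≟ false) ×-dec (t (next j) ≟ true)

module _ {n : ℕ} {t : Fin (suc n) → Bool} {β : Fin (suc n)} (consec : Consecutive t β) where

  private
    inBlock : ∀ {j} → t j ≡ true → ∃[ s ] (s < count t × j ≡ cyc β s)
    inBlock {j} = Equivalence.to (consec j)

    blockCell : ∀ s → s < count t → t (cyc β s) ≡ true
    blockCell s s<h = Equivalence.from (consec (cyc β s)) (s , s<h , refl)

  consecutive-start : ∀ {j₀} → t j₀ ≡ true → t β ≡ true
  consecutive-start tj₀ = let (s , s<h , _) = inBlock tj₀ in blockCell 0 (≤-trans (s≤s z≤n) s<h)

  consecutive-outside : ∀ s → count t ≤ s → s < suc n → t (cyc β s) ≡ false
  consecutive-outside s h≤s s<N = ≢true⇒≡false λ ts → let (s' , s'<h , eq) = inBlock ts in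
    <⇒≱ s'<h (subst (count t ≤_) (cyc-injective β s<N (<-≤-trans s'<h (count-≤ t)) eq) h≤s)

  consecutive-precedes⇒start : ∀ {j} → PrecedesBlock t j → next j ≡ β
  consecutive-precedes⇒start {j} (tj≡f , tnj≡t) with inBlock tnj≡t
  ... | zero  , _       , eq = eq
  ... | suc s , 1+s<h   , eq = ⊥-elim (true≢false (trans (sym (blockCell s (<-trans (n<1+n s) 1+s<h)))
                                 (trans (cong t (sym (next-injective j (cyc β s) eq))) tj≡f)))

  consecutive-full : t β ≡ true → (∀ j → ¬ PrecedesBlock t j) → suc n ∸ count t ≡ 0
  consecutive-full tβ noGap with t (cyc β n) in eq
  ... | false = ⊥-elim (noGap (cyc β n) (eq , subst (λ j → t j ≡ true) (sym (cyc-period β)) tβ))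
  ... | true = let (s , s<h , last≡s) = inBlock eq in
    m≤n⇒m∸n≡0 (subst (λ s → suc s ≤ count t)
                      (sym (cyc-injective β (n<1+n n) (<-≤-trans s<h (count-≤ t)) last≡s)) s<h)

asGroup : PGroup → Group _ _
asGroup G = record { PGroup G }

module _ (G : PGroup) where
  open PGroup G
  open IsGroup isGroup using (assoc; identityˡ; identityʳ; inverseʳ)
  open import Algebra.Properties.Group (asGroup G) using (inverseˡ-unique; ε⁻¹≈ε; ⁻¹-involutive; ⁻¹-injective)

  gsum-++ : ∀ xs ys → gsum G (xs ++ ys) ≡ gsum G xs ∙ gsum G ys
  gsum-++ []       ys = sym (identityˡ _)
  gsum-++ (x ∷ xs) ys = trans (cong (x ∙_) (gsum-++ xs ys)) (sym (assoc _ _ _))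

  gsum-map-val : ∀ {A : Set} (f : A → Maybe Carrier) xs → gsum G (map (val G ∘ f) xs) ≡ gsum G (mapMaybe f xs)
  gsum-map-val f []       = refl
  gsum-map-val f (x ∷ xs) with f x
  ... | just a  = cong (a ∙_) (gsum-map-val f xs)
  ... | nothing = trans (identityˡ _) (gsum-map-val f xs)

  x∙y≡ε⇒y∙x≡ε : ∀ {x y} → x ∙ y ≡ ε → y ∙ x ≡ ε
  x∙y≡ε⇒y∙x≡ε {x} {y} x∙y≡ε = trans (cong (y ∙_) (inverseˡ-unique x y x∙y≡ε)) (inverseʳ y)

  rotatedSum : ∀ {n} → (Fin (suc n) → Carrier) → Fin (suc n) → Carrier
  rotatedSum {n} g β = gsum G (applyUpTo (g ∘ cyc β) (suc n))

  rotatedSum-next : ∀ {n} (g : Fin (suc n) → Carrier) β → rotatedSum g β ≡ ε → rotatedSum g (next β) ≡ ε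
  rotatedSum-next {n} g β sum≡ε = trans rotated (x∙y≡ε⇒y∙x≡ε sum≡ε)
    where
    open ≡-Reasoning
    tail : Carrier
    tail = gsum G (applyUpTo (g ∘ cyc β ∘ suc) n)
    rotated : rotatedSum g (next β) ≡ tail ∙ g β
    rotated = begin
      rotatedSum g (next β)
        ≡⟨ cong (gsum G) (applyUpTo-∷ʳ (g ∘ cyc (next β)) n) ⟨
      gsum G (applyUpTo (g ∘ cyc (next β)) n ++ g (cyc (next β) n) ∷ [])
        ≡⟨ gsum-++ (applyUpTo (g ∘ cyc (next β)) n) _ ⟩
      gsum G (applyUpTo (g ∘ cyc (next β)) n) ∙ (g (cyc (next β) n) ∙ ε)
        ≡⟨ cong₂ _∙_ (cong (gsum G) (applyUpTo-cong n (λ s _ → cong g (cyc-next β s))))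
                     (trans (identityʳ _) (cong g (trans (cyc-next β n) (cyc-period β)))) ⟩
      tail ∙ g β ∎

  rotatedSum≡ε : ∀ {n} (g : Fin (suc n) → Carrier) → gsum G (map g (allFin (suc n))) ≡ ε →
                 ∀ β → rotatedSum g β ≡ ε
  rotatedSum≡ε {n} g sum≡ε β = subst (λ γ → rotatedSum g γ ≡ ε) (cyc-zero-toℕ β) (fromZero (toℕ β))
    where
    fromZero : ∀ s → rotatedSum g (cyc fzero s) ≡ ε
    fromZero zero    = trans (cong (gsum G) (trans (applyUpTo-cyc-zero n g) (sym (map-tabulate id g)))) sum≡ε
    fromZero (suc s) = rotatedSum-next g _ (fromZero s)

  blockSum : ∀ {k} → (Fin k → Bool) → (Fin k → Maybe Carrier) → Fin k → Carrier
  blockSum t q β = gsum G (map (λ s → val G (q (cyc β s))) (upTo (count t)))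

  restSum : ∀ {k} → (Fin k → Bool) → (Fin k → Maybe Carrier) → Fin k → Carrier
  restSum {k} t p β = gsum G (map (λ s → val G (p (cyc β (count t + s)))) (upTo (k ∸ count t)))

  -- It depends only on the shape of t, so it can be handed to a nice tile before
  -- the tile chooses β; by lineTarget≡restSum⁻¹ it is the one block sum that
  -- makes the whole line sum vanish.
  lineTarget : ∀ {k} → (Fin k → Bool) → (Fin k → Maybe Carrier) → Carrier
  lineTarget t p with any? (precedesBlock? t)
  ... | yes (j , _) = restSum t p (next j) ⁻¹
  ... | no _        = ε

  module _ {n : ℕ} {t : Fin (suc n) → Bool} {β : Fin (suc n)} (consec : Consecutive t β) where

    lineTarget≡restSum⁻¹ : ∀ (p : Fin (suc n) → Maybe Carrier) {j₀} → t j₀ ≡ true →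
                           lineTarget t p ≡ restSum t p β ⁻¹
    lineTarget≡restSum⁻¹ p tj₀ with any? (precedesBlock? t)
    ... | yes (j , pre) = cong (λ γ → restSum t p γ ⁻¹) (consecutive-precedes⇒start consec pre)
    ... | no noGap = trans (sym ε⁻¹≈ε) (cong _⁻¹ (sym emptyRest))
      where
      emptyRest : restSum t p β ≡ ε
      emptyRest = cong (λ len → gsum G (map (λ s → val G (p (cyc β (count t + s)))) (upTo len)))
        (consecutive-full consec (consecutive-start consec tj₀) (λ j pre → noGap (j , pre)))

    rotatedLine≡block++rest : (q p : Fin (suc n) → Maybe Carrier) →
      (∀ j → is-just (q j) ≡ t j) → (∀ j → t j ≡ true → p j ≡ nothing) →
      applyUpTo (λ s → val G (q (cyc β s) <∣> p (cyc β s))) (suc n)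
        ≡ map (λ s → val G (q (cyc β s))) (upTo (count t))
          ++ map (λ s → val G (p (cyc β (count t + s)))) (upTo (suc n ∸ count t))
    rotatedLine≡block++rest q p skel-q p∩t=∅ = begin
      applyUpTo line (suc n)
        ≡⟨ cong (applyUpTo line) (m+[n∸m]≡n h≤N) ⟨
      applyUpTo line (h + (suc n ∸ h))
        ≡⟨ applyUpTo-+ line h (suc n ∸ h) ⟩
      applyUpTo line h ++ applyUpTo (λ s → line (h + s)) (suc n ∸ h)
        ≡⟨ cong₂ _++_ (applyUpTo-cong h block) (applyUpTo-cong (suc n ∸ h) rest) ⟩
      applyUpTo (λ s → val G (q (cyc β s))) h ++ applyUpTo (λ s → val G (p (cyc β (h + s)))) (suc n ∸ h)
        ≡⟨ cong₂ _++_ (map-applyUpTo id _ h) (map-applyUpTo id _ (suc n ∸ h)) ⟨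
      map (λ s → val G (q (cyc β s))) (upTo h) ++ map (λ s → val G (p (cyc β (h + s)))) (upTo (suc n ∸ h)) ∎
      where
      open ≡-Reasoning
      h : ℕ
      h = count t
      h≤N : h ≤ suc n
      h≤N = count-≤ t
      line : ℕ → Carrier
      line s = val G (q (cyc β s) <∣> p (cyc β s))
      block : ∀ s → s < h → line s ≡ val G (q (cyc β s))
      block s s<h = trans
        (cong (λ x → val G (q (cyc β s) <∣> x)) (p∩t=∅ _ (Equivalence.from (consec (cyc β s)) (s , s<h , refl))))
        (cong (val G) (<∣>-identityʳ (q (cyc β s))))
      rest : ∀ s → s < suc n ∸ h → line (h + s) ≡ val G (p (cyc β (h + s)))
      rest s s<N∸h = cong (λ x → val G (x <∣> p (cyc β (h + s))))
        (is-just≡false⇒nothing _ (trans (skel-q _) (consecutive-outside consec (h + s) (m≤m+n h s)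
          (subst (h + s <_) (m+[n∸m]≡n h≤N) (+-monoʳ-< h s<N∸h)))))

    lineSum≡ε⇒blockSum∙restSum≡ε : (q p : Fin (suc n) → Maybe Carrier) →
      (∀ j → is-just (q j) ≡ t j) → (∀ j → t j ≡ true → p j ≡ nothing) →
      gsum G (mapMaybe (λ j → q j <∣> p j) (allFin (suc n))) ≡ ε → blockSum t q β ∙ restSum t p β ≡ ε
    lineSum≡ε⇒blockSum∙restSum≡ε q p skel-q p∩t=∅ sum≡ε = begin
      blockSum t q β ∙ restSum t p β
        ≡⟨ gsum-++ (map (λ s → val G (q (cyc β s))) (upTo (count t))) _ ⟨
      gsum G (map (λ s → val G (q (cyc β s))) (upTo (count t))
              ++ map (λ s → val G (p (cyc β (count t + s)))) (upTo (suc n ∸ count t)))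
        ≡⟨ cong (gsum G) (rotatedLine≡block++rest q p skel-q p∩t=∅) ⟨
      rotatedSum (λ j → val G (q j <∣> p j)) β
        ≡⟨ rotatedSum≡ε _ (trans (gsum-map-val (λ j → q j <∣> p j) (allFin (suc n))) sum≡ε) β ⟩
      ε ∎
      where open ≡-Reasoning

    blockSum≢lineTarget⇒lineSum≢ε : (q p : Fin (suc n) → Maybe Carrier) →
      (∀ j → is-just (q j) ≡ t j) → (∀ j → t j ≡ true → p j ≡ nothing) → ∀ {j₀} → t j₀ ≡ true →
      blockSum t q β ≢ lineTarget t p → gsum G (mapMaybe (λ j → q j <∣> p j) (allFin (suc n))) ≢ ε
    blockSum≢lineTarget⇒lineSum≢ε q p skel-q p∩t=∅ tj₀ block≢target sum≡ε = block≢target (trans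
      (inverseˡ-unique _ _ (lineSum≡ε⇒blockSum∙restSum≡ε q p skel-q p∩t=∅ sum≡ε))
      (sym (lineTarget≡restSum⁻¹ p tj₀)))

  mergedLineSum≢ε : ∀ {k} (t u : Fin k → Bool) (q p : Fin k → Maybe Carrier) →
    (∀ j → is-just (q j) ≡ t j) → (∀ j → is-just (p j) ≡ u j) → (∀ j → t j ≡ true → u j ≡ false) →
    ((∃[ j ] t j ≡ true) → ∃[ β ] (Consecutive t β × blockSum t q β ≢ lineTarget t p)) →
    ((∃[ j ] u j ≡ true) → gsum G (mapMaybe p (allFin k)) ≢ ε) →
    (∃[ j ] (t j ∨ u j) ≡ true) → gsum G (mapMaybe (λ j → q j <∣> p j) (allFin k)) ≢ ε
  mergedLineSum≢ε {zero} t u q p _ _ _ _ _ (() , _)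
  mergedLineSum≢ε {suc n} t u q p skel-q skel-p t∩u=∅ newLine oldLine (j₁ , tu) with any? (λ j → t j ≟ true)
  ... | yes (j₀ , tj₀) =
    let β , consec , block≢target = newLine (j₀ , tj₀)
    in blockSum≢lineTarget⇒lineSum≢ε consec q p skel-q
         (λ j tj → is-just≡false⇒nothing (p j) (trans (skel-p j) (t∩u=∅ j tj))) tj₀ block≢target
  ... | no notInT = subst (λ xs → gsum G xs ≢ ε) (sym (mapMaybe-cong onlyOld (allFin (suc n))))
                      (oldLine (j₁ , trans (cong (_∨ u j₁) (sym (tFalse j₁))) tu))
    where
    tFalse : ∀ j → t j ≡ false
    tFalse j = ≢true⇒≡false (λ tj → notInT (j , tj))
    onlyOld : ∀ j → (q j <∣> p j) ≡ p j
    onlyOld j = cong (_<∣> p j) (is-just≡false⇒nothing (q j) (trans (skel-q j) (tFalse j)))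

  record Filling {m n} (U : Cells m n) (S : List Carrier) (F : PFArray m n Carrier) : Set where
    field
      skel≗     : ∀ i j → skel F i j ≡ U i j
      entries↭  : entries F ↭ S
      rowSum≢ε  : ∀ i → (∃[ j ] U i j ≡ true) → gsum G (rowEntries F i) ≢ ε
      colSum≢ε  : ∀ j → (∃[ i ] U i j ≡ true) → gsum G (colEntries F j) ≢ ε

  emptyFilling : ∀ {m n} → Filling {m} {n} (λ _ _ → false) [] (λ _ _ → nothing)
  emptyFilling {m} {n} = record
    { skel≗    = λ _ _ → refl
    ; entries↭ = ↭-reflexive (noEntries (allFin m))
    ; rowSum≢ε = λ { _ (_ , ()) }
    ; colSum≢ε = λ { _ (_ , ()) }
    }
    where
    noEntries : ∀ is →
      concatMap (λ (_ : Fin m) → mapMaybe (λ (_ : Fin n) → nothing {A = Carrier}) (allFin n)) is ≡ []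
    noEntries []       = refl
    noEntries (_ ∷ is) = cong₂ _++_ (mapMaybe-nothing (allFin n)) (noEntries is)

  extendFilling : ∀ {m n} {T U : Cells m n} {S₀ S F} → NiceTile T → Unique S₀ → length S₀ ≡ size T →
                  Disjoint T U → Filling U S F → ∃[ F' ] Filling (T ∪ U) (S₀ ++ S) F'
  extendFilling {m} {n} {T} {U} {S₀} {S} {F} nice unique-S₀ |S₀|≡|T| T∩U=∅ filled
    with nice G S₀ unique-S₀ |S₀|≡|T| (λ i → lineTarget (T i) (F i))
                                      (λ j → lineTarget (λ i → T i j) (λ i → F i j))
  ... | F₀ , skel₀ , entries₀ , rows₀ , cols₀ = (λ i j → F₀ i j <∣> F i j) , record
    { skel≗    = λ i j → trans (is-just-<∣> (F₀ i j) (F i j)) (cong₂ _∨_ (skel₀ i j) (skel≗ i j))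
    ; entries↭ = ↭-trans
        (concatMap-↭-++ _ _ _ (allFin m) (λ i → mapMaybe-<∣> (F₀ i) (F i) (allFin n)
          (λ j inF₀ → emptyOnT i j (trans (sym (skel₀ i j)) inF₀))))
        (++⁺ entries₀ entries↭)
    ; rowSum≢ε = λ i → mergedLineSum≢ε (T i) (U i) (F₀ i) (F i)
                         (skel₀ i) (skel≗ i) (T∩U=∅ i) (rows₀ i) (rowSum≢ε i)
    ; colSum≢ε = λ j → mergedLineSum≢ε (λ i → T i j) (λ i → U i j) (λ i → F₀ i j) (λ i → F i j)
                         (λ i → skel₀ i j) (λ i → skel≗ i j) (λ i → T∩U=∅ i j) (cols₀ j) (colSum≢ε j)
    }
    where
    open Filling filled
    emptyOnT : ∀ i j → T i j ≡ true → F i j ≡ nothing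
    emptyOnT i j tT = is-just≡false⇒nothing (F i j) (trans (skel≗ i j) (T∩U=∅ i j tT))

  fillTiles : ∀ {m n ℓ} (supply : ℕ → Carrier) (w : ℕ) → (∀ a b → b ≤ w → Unique (window supply a b)) →
    (T : Fin ℓ → Cells m n) → (∀ r → NiceTile (T r)) → PairwiseDisjoint T → (∀ r → size (T r) ≤ w) →
    ∀ a → ∃[ F ] Filling (⋃ T) (window supply a (totalSize T)) F
  fillTiles {ℓ = zero}  supply w windows T nice disj small a = _ , emptyFilling
  fillTiles {ℓ = suc ℓ} supply w windows T nice disj small a =
    let _ , filled = fillTiles supply w windows (T ∘ fsuc) (nice ∘ fsuc) (PairwiseDisjoint-tail T disj)
                       (small ∘ fsuc) (a + size (T fzero))
    in subst (λ S → ∃[ F ] Filling (⋃ T) S F) (sym (window-+ supply a (size (T fzero)) _))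
         (extendFilling (nice fzero) (windows a _ (small fzero)) (length-applyUpTo _ _)
           (head-disjoint-⋃tail T disj) filled)

-- The multiset condition

module _ (G : PGroup) where
  open PGroup G

  withInverses : List Carrier → List Carrier
  withInverses = concatMap (λ x → x ∷ x ⁻¹ ∷ [])

  withInverses-↭ : ∀ xs → withInverses xs ↭ xs ++ map _⁻¹ xs
  withInverses-↭ []       = ↭-refl
  withInverses-↭ (x ∷ xs) =
    ↭-prep x (↭-trans (↭-prep (x ⁻¹) (withInverses-↭ xs)) (↭-sym (shift (x ⁻¹) xs (map _⁻¹ xs))))

  withInverses-++ : ∀ xs ys → withInverses (xs ++ ys) ≡ withInverses xs ++ withInverses ys
  withInverses-++ = concatMap-++ (λ x → x ∷ x ⁻¹ ∷ [])

  withInverses-concat-replicate : ∀ {X Y} q → withInverses X ↭ Y →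
                                  withInverses (concat (replicate q X)) ↭ concat (replicate q Y)
  withInverses-concat-replicate         zero    _ = ↭-refl
  withInverses-concat-replicate {X} {Y} (suc q) X↭Y =
    subst (_↭ Y ++ concat (replicate q Y)) (sym (withInverses-++ X (concat (replicate q X))))
      (++⁺ X↭Y (withInverses-concat-replicate q X↭Y))

-- d is the junk value returned past the end of the list.
nth : ∀ {A : Set} → A → List A → ℕ → A
nth d []       _       = d
nth d (x ∷ xs) zero    = x
nth d (x ∷ xs) (suc i) = nth d xs i

module _ {A : Set} (d : A) where

  applyUpTo-nth-++ : ∀ xs ys → applyUpTo (nth d (xs ++ ys)) (length xs) ≡ xs
  applyUpTo-nth-++ []       ys = refl
  applyUpTo-nth-++ (x ∷ xs) ys = cong (x ∷_) (applyUpTo-nth-++ xs ys)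

  nth-∈ : ∀ xs i → i < length xs → nth d xs i ∈ xs
  nth-∈ (x ∷ xs) zero    _         = here refl
  nth-∈ (x ∷ xs) (suc i) (s≤s i<n) = there (nth-∈ xs i i<n)

  nth-injective : ∀ xs → Unique xs → ∀ i j → i < length xs → j < length xs → nth d xs i ≡ nth d xs j → i ≡ j
  nth-injective (x ∷ xs) _          zero    zero    _         _         _  = refl
  nth-injective (x ∷ xs) (x∉ ∷ _)   zero    (suc j) _         (s≤s j<n) eq =
    ⊥-elim (All.lookup x∉ (nth-∈ xs j j<n) eq)
  nth-injective (x ∷ xs) (x∉ ∷ _)   (suc i) zero    (s≤s i<n) _         eq =
    ⊥-elim (All.lookup x∉ (nth-∈ xs i i<n) (sym eq))
  nth-injective (x ∷ xs) (_ ∷ uniq) (suc i) (suc j) (s≤s i<n) (s≤s j<n) eq =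
    cong suc (nth-injective xs uniq i j i<n j<n eq)

module Periodic {A : Set} (d : A) (U : List A) {w' : ℕ} (|U|≡w : length U ≡ suc w') (unique-U : Unique U) where

  w : ℕ
  w = suc w'

  supply : ℕ → A
  supply p = nth d U (p % w)

  window-unique : ∀ a b → b ≤ w → Unique (window supply a b)
  window-unique a b b≤w = Unique.applyUpTo⁺₁ (λ i → supply (a + i)) b λ {i} {j} i<j j<b eq →
    %-injective-on-window w (+-monoʳ-< a i<j)
      (<-≤-trans (+-monoʳ-< a (<-≤-trans j<b b≤w)) (+-monoˡ-≤ w (m≤m+n a i)))
      (nth-injective d U unique-U _ _ (subst ((a + i) % w <_) (sym |U|≡w) (m%n<n (a + i) w))
                                      (subst ((a + j) % w <_) (sym |U|≡w) (m%n<n (a + j) w)) eq)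

  window-prefix : ∀ P Q → U ≡ P ++ Q → window supply 0 (length P) ≡ P
  window-prefix P Q U≡P++Q = trans
    (applyUpTo-cong (length P) (λ i i<|P| → cong (nth d U) (m<n⇒m%n≡m (<-≤-trans i<|P| |P|≤w))))
    (subst (λ V → applyUpTo (nth d V) (length P) ≡ P) (sym U≡P++Q) (applyUpTo-nth-++ d P Q))
    where
    |P|≤w : length P ≤ w
    |P|≤w = subst (length P ≤_) (trans (sym (length-++ P)) (trans (cong length (sym U≡P++Q)) |U|≡w))
                  (m≤m+n (length P) (length Q))

  window-period : window supply 0 w ≡ U
  window-period = subst (λ b → window supply 0 b ≡ U) |U|≡w (window-prefix U [] (sym (++-identityʳ U)))

  window-shift : ∀ b → window supply w b ≡ window supply 0 b
  window-shift b = applyUpTo-cong b (λ i _ → cong (nth d U) (trans (cong (_% w) (+-comm w i)) ([m+n]%n≡m%n i w)))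

  window-periodic : ∀ P Q → U ≡ P ++ Q → ∀ q → window supply 0 (q * w + length P) ≡ concat (replicate q U) ++ P
  window-periodic P Q U≡P++Q zero    = window-prefix P Q U≡P++Q
  window-periodic P Q U≡P++Q (suc q) = begin
    window supply 0 (w + q * w + length P)
      ≡⟨ cong (window supply 0) (+-assoc w (q * w) (length P)) ⟩
    window supply 0 (w + (q * w + length P))
      ≡⟨ window-+ supply 0 w (q * w + length P) ⟩
    window supply 0 w ++ window supply w (q * w + length P)
      ≡⟨ cong₂ _++_ window-period (trans (window-shift _) (window-periodic P Q U≡P++Q q)) ⟩
    U ++ (concat (replicate q U) ++ P)
      ≡⟨ ++-assoc U _ P ⟨
    (U ++ concat (replicate q U)) ++ P ∎
    where open ≡-Reasoning

module Outside (G : PGroup) {v : ℕ} (e : PGroup.Carrier G ↔ Fin v)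
               (J : PGroup.Carrier G → Bool) (J-subgroup : IsSubgroup G J) where
  open PGroup G
  open IsSubgroup J-subgroup
  open IsGroup isGroup using (inverseʳ)
  open import Algebra.Properties.Group (asGroup G) using (⁻¹-involutive; ⁻¹-injective)
  open Inverse e using (to; from; strictlyInverseˡ; strictlyInverseʳ)

  elements : List Carrier
  elements = map from (allFin v)

  elements-unique : Unique elements
  elements-unique = Unique.map⁺
    (λ {x} {y} eq → trans (sym (strictlyInverseˡ x)) (trans (cong to eq) (strictlyInverseˡ y))) (Unique.allFin⁺ v)

  ∈-elements : ∀ z → z ∈ elements
  ∈-elements z = subst (_∈ elements) (strictlyInverseʳ z) (∈-map⁺ from (∈-allFin (to z)))

  O : List Carrier
  O = outsideList G e J

  IsOutsideEnumeration : List Carrier → Set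
  IsOutsideEnumeration X = Unique X × (∀ z → z ∈ X ⇔ J z ≡ false)

  O-enumeration : IsOutsideEnumeration O
  O-enumeration = Unique.filter⁺ (T? ∘ (not ∘ J)) {xs = elements} elements-unique , λ z → mk⇔
    (λ z∈O → Equivalence.to T-not-≡ (proj₂ (∈-filter⁻ (T? ∘ (not ∘ J)) {xs = elements} z∈O)))
    (λ Jz≡f → ∈-filter⁺ (T? ∘ (not ∘ J)) (∈-elements z) (Equivalence.from T-not-≡ Jz≡f))

  enumeration-↭ : ∀ {X} → IsOutsideEnumeration X → X ↭ O
  enumeration-↭ (unique-X , ∈X) = unique-sameMembers⇒↭ unique-X (proj₁ O-enumeration) λ z →
    mk⇔ (Equivalence.from (proj₂ O-enumeration z) ∘ Equivalence.to (∈X z))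
        (Equivalence.from (∈X z) ∘ Equivalence.to (proj₂ O-enumeration z))

  J-⁻¹ : ∀ z → J (z ⁻¹) ≡ J z
  J-⁻¹ z with J z in Jz | J (z ⁻¹) in Jz⁻¹
  ... | true  | true  = refl
  ... | false | false = refl
  ... | true  | false = ⊥-elim (true≢false (trans (sym (⁻¹∈ Jz)) Jz⁻¹))
  ... | false | true  =
    ⊥-elim (true≢false (trans (sym (subst (λ x → J x ≡ true) (⁻¹-involutive z) (⁻¹∈ Jz⁻¹))) Jz))

  map-⁻¹-enumeration : ∀ {X} → IsOutsideEnumeration X → IsOutsideEnumeration (map _⁻¹ X)
  map-⁻¹-enumeration {X} (unique-X , ∈X) = Unique.map⁺ ⁻¹-injective unique-X , λ z → mk⇔
    (λ z∈X⁻¹ → let y , y∈X , z≡y⁻¹ = ∈-map⁻ _⁻¹ z∈X⁻¹ in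
       trans (cong J z≡y⁻¹) (trans (J-⁻¹ y) (Equivalence.to (∈X y) y∈X)))
    (λ Jz≡f → subst (_∈ map _⁻¹ X) (⁻¹-involutive z)
       (∈-map⁺ _⁻¹ (Equivalence.from (∈X (z ⁻¹)) (trans (J-⁻¹ z) Jz≡f))))

  withInverses-enumeration : ∀ {X} → IsOutsideEnumeration X → withInverses G X ↭ O ++ O
  withInverses-enumeration {X} X-enum =
    ↭-trans (withInverses-↭ G X) (++⁺ (enumeration-↭ X-enum) (enumeration-↭ (map-⁻¹-enumeration X-enum)))

  length-J-elements : ∀ {t} → Σ Carrier (λ x → J x ≡ true) ↔ Fin t → length (filterᵇ J elements) ≡ t
  length-J-elements {t} eJ = trans (↭-length (unique-sameMembers⇒↭
      (Unique.filter⁺ (T? ∘ J) {xs = elements} elements-unique) unique-inJ (λ z → mk⇔ (into z) (outof z))))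
    (trans (length-map _ (allFin t)) (length-tabulate id))
    where
    open Inverse eJ renaming (to to toJ; from to fromJ; strictlyInverseˡ to invˡ; strictlyInverseʳ to invʳ)
    inJ : List Carrier
    inJ = map (proj₁ ∘ fromJ) (allFin t)
    proj₁-injective : ∀ (a b : Σ Carrier (λ x → J x ≡ true)) → proj₁ a ≡ proj₁ b → a ≡ b
    proj₁-injective (x , p) (.x , q) refl = cong (x ,_) (uip p q)
    unique-inJ : Unique inJ
    unique-inJ = Unique.map⁺ (λ {i} {i'} eq → trans (sym (invˡ i))
                   (trans (cong toJ (proj₁-injective (fromJ i) (fromJ i') eq)) (invˡ i'))) (Unique.allFin⁺ t)
    into : ∀ z → z ∈ filterᵇ J elements → z ∈ inJ
    into z z∈ = let Jz≡t = Equivalence.to T-≡ (proj₂ (∈-filter⁻ (T? ∘ J) {xs = elements} z∈)) in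
      subst (_∈ inJ) (cong proj₁ (invʳ (z , Jz≡t))) (∈-map⁺ (proj₁ ∘ fromJ) (∈-allFin (toJ (z , Jz≡t))))
    outof : ∀ z → z ∈ inJ → z ∈ filterᵇ J elements
    outof z z∈ = let i , _ , z≡ = ∈-map⁻ (proj₁ ∘ fromJ) z∈ in
      ∈-filter⁺ (T? ∘ J) (∈-elements z) (Equivalence.from T-≡ (trans (cong J z≡) (proj₂ (fromJ i))))

  t+|O|≡v : ∀ {t} → Σ Carrier (λ x → J x ≡ true) ↔ Fin t → t + length O ≡ v
  t+|O|≡v eJ = begin
    _ + length O                                                 ≡⟨ cong (_+ length O) (length-J-elements eJ) ⟨
    length (filterᵇ J elements) + length O                       ≡⟨ length-filterᵇ+length-filterᵇ-not J elements ⟩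
    length elements                                              ≡⟨ length-map from (allFin v) ⟩
    length (allFin v)                                            ≡⟨ length-tabulate id ⟩
    v                                                            ∎
    where open ≡-Reasoning

  module NoInvolution (noInvolution : ¬ HasInvolutionOutside G J) where

    index : Carrier → ℕ
    index z = toℕ (to z)

    index≢index-⁻¹ : ∀ z → J z ≡ false → index z ≢ index (z ⁻¹)
    index≢index-⁻¹ z Jz≡f eq = noInvolution (z , Jz≡f , z≢ε , z∙z≡ε)
      where
      z≡z⁻¹ : z ≡ z ⁻¹
      z≡z⁻¹ = trans (sym (strictlyInverseʳ z)) (trans (cong from (toℕ-injective eq)) (strictlyInverseʳ (z ⁻¹)))
      z∙z≡ε : z ∙ z ≡ ε
      z∙z≡ε = trans (cong (z ∙_) z≡z⁻¹) (inverseʳ z)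
      z≢ε : z ≢ ε
      z≢ε z≡ε = true≢false (trans (sym (subst (λ x → J x ≡ true) (sym z≡ε) ε∈)) Jz≡f)

    -- z ↦ z⁻¹ pairs off G \ J without fixed points; Φ keeps the element of
    -- smaller index from each pair.
    Φ : List Carrier
    Φ = filterᵇ (λ z → index z <ᵇ index (z ⁻¹)) O

    ∈Φ⇔ : ∀ z → z ∈ Φ ⇔ (J z ≡ false × index z < index (z ⁻¹))
    ∈Φ⇔ z = mk⇔
      (λ z∈Φ → let z∈O , lt = ∈-filter⁻ (T? ∘ (λ z → index z <ᵇ index (z ⁻¹))) {xs = O} z∈Φ in
                 Equivalence.to (proj₂ O-enumeration z) z∈O , <ᵇ⇒< _ _ lt)
      (λ (Jz≡f , lt) → ∈-filter⁺ (T? ∘ (λ z → index z <ᵇ index (z ⁻¹))) {xs = O}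
                         (Equivalence.from (proj₂ O-enumeration z) Jz≡f) (<⇒<ᵇ lt))

    halves-enumeration : IsOutsideEnumeration (Φ ++ map _⁻¹ Φ)
    halves-enumeration =
      Unique.++⁺ unique-Φ (Unique.map⁺ ⁻¹-injective unique-Φ) disjoint , λ z → mk⇔ (outside z) (inHalves z)
      where
      unique-Φ : Unique Φ
      unique-Φ = Unique.filter⁺ (T? ∘ (λ z → index z <ᵇ index (z ⁻¹))) {xs = O} (proj₁ O-enumeration)
      inΦ : ∀ {z} → z ∈ Φ → J z ≡ false × index z < index (z ⁻¹)
      inΦ {z} = Equivalence.to (∈Φ⇔ z)
      toΦ : ∀ {z} → J z ≡ false × index z < index (z ⁻¹) → z ∈ Φ
      toΦ {z} = Equivalence.from (∈Φ⇔ z)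
      disjoint : ∀ {z} → ¬ (z ∈ Φ × z ∈ map _⁻¹ Φ)
      disjoint {z} (z∈Φ , z∈Φ⁻¹) = let y , y∈Φ , z≡y⁻¹ = ∈-map⁻ _⁻¹ z∈Φ⁻¹ in
        <-asym (proj₂ (inΦ z∈Φ))
          (subst (λ u → index u < index z) (sym (trans (cong _⁻¹ z≡y⁻¹) (⁻¹-involutive y)))
            (subst (λ u → index y < index u) (sym z≡y⁻¹) (proj₂ (inΦ y∈Φ))))
      outside : ∀ z → z ∈ Φ ++ map _⁻¹ Φ → J z ≡ false
      outside z z∈ with ∈-++⁻ Φ z∈
      ... | inj₁ z∈Φ   = proj₁ (inΦ z∈Φ)
      ... | inj₂ z∈Φ⁻¹ = let y , y∈Φ , z≡y⁻¹ = ∈-map⁻ _⁻¹ z∈Φ⁻¹ in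
        trans (cong J z≡y⁻¹) (trans (J-⁻¹ y) (proj₁ (inΦ y∈Φ)))
      inHalves : ∀ z → J z ≡ false → z ∈ Φ ++ map _⁻¹ Φ
      inHalves z Jz≡f with <-cmp (index z) (index (z ⁻¹))
      ... | tri< lt _ _ = ∈-++⁺ˡ (toΦ (Jz≡f , lt))
      ... | tri≈ _ eq _ = ⊥-elim (index≢index-⁻¹ z Jz≡f eq)
      ... | tri> _ _ gt = ∈-++⁺ʳ Φ (subst (_∈ map _⁻¹ Φ) (⁻¹-involutive z) (∈-map⁺ _⁻¹
          (toΦ (trans (J-⁻¹ z) Jz≡f , subst (λ u → index (z ⁻¹) < index u) (sym (⁻¹-involutive z)) gt))))

    withInverses-Φ : withInverses G Φ ↭ O
    withInverses-Φ = ↭-trans (withInverses-↭ G Φ) (enumeration-↭ halves-enumeration)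

  record Supply (λ' w N : ℕ) : Set where
    field
      supply              : ℕ → Carrier
      window-unique       : ∀ a b → b ≤ w → Unique (window supply a b)
      withInverses-prefix : withInverses G (window supply 0 N) ↭ concat (replicate λ' O)

  periodicSupply : ∀ {w'} P Q → IsOutsideEnumeration (P ++ Q) → length (P ++ Q) ≡ suc w' →
    ∀ ρ → withInverses G P ↭ concat (replicate ρ O) → ∀ q → Supply (ρ + q * 2) (suc w') (q * suc w' + length P)
  periodicSupply {w'} P Q U-enum |U|≡w ρ P± q = record
    { supply              = supply
    ; window-unique       = window-unique
    ; withInverses-prefix = begin
        withInverses G (window supply 0 (q * suc w' + length P))
          ≡⟨ cong (withInverses G) (window-periodic P Q refl q) ⟩
        withInverses G (concat (replicate q (P ++ Q)) ++ P)
          ≡⟨ withInverses-++ G (concat (replicate q (P ++ Q))) P ⟩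
        withInverses G (concat (replicate q (P ++ Q))) ++ withInverses G P
          ↭⟨ ++⁺ (withInverses-concat-replicate G q (withInverses-enumeration U-enum)) P± ⟩
        concat (replicate q (O ++ O)) ++ concat (replicate ρ O)
          ↭⟨ ++-comm (concat (replicate q (O ++ O))) _ ⟩
        concat (replicate ρ O) ++ concat (replicate q (O ++ O))
          ≡⟨ cong (concat (replicate ρ O) ++_) (concat-replicate-*2 O q) ⟨
        concat (replicate ρ O) ++ concat (replicate (q * 2) O)
          ≡⟨ concat-replicate-+ O ρ (q * 2) ⟨
        concat (replicate (ρ + q * 2) O) ∎
    }
    where
    open Periodic ε (P ++ Q) |U|≡w (proj₁ U-enum)
    open PermutationReasoning

  emptySupply : ∀ λ' → length O ≡ 0 → Supply λ' 0 0
  emptySupply λ' |O|≡0 = record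
    { supply              = λ _ → ε
    ; window-unique       = λ a b b≤0 → subst (λ b → Unique (window (λ _ → ε) a b)) (sym (n≤0⇒n≡0 b≤0)) []
    ; withInverses-prefix = ↭-reflexive (sym (trans (cong (λ X → concat (replicate λ' X)) (length≡0⇒[] O |O|≡0))
                                                    (concat-replicate-[] λ')))
    }

  evenSupply : ∀ {w'} → length O ≡ suc w' → ∀ q → Supply (0 + q * 2) (suc w') (q * suc w' + 0)
  evenSupply |O|≡w q = periodicSupply [] O O-enumeration |O|≡w 0 ↭-refl q

  oddSupply : ¬ HasInvolutionOutside G J → ∀ {w'} → length O ≡ suc w' →
              ∃[ c ] (c + c ≡ suc w' × ∀ q → Supply (1 + q * 2) (suc w') (q * suc w' + c))
  oddSupply noInvolution {w'} |O|≡w =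
    length Φ , |Φ|+|Φ|≡w , periodicSupply Φ (map _⁻¹ Φ) halves-enumeration |U|≡w 1
                             (↭-trans withInverses-Φ (↭-reflexive (sym (++-identityʳ O))))
    where
    open NoInvolution noInvolution
    |U|≡w : length (Φ ++ map _⁻¹ Φ) ≡ suc w'
    |U|≡w = trans (↭-length (enumeration-↭ halves-enumeration)) |O|≡w
    |Φ|+|Φ|≡w : length Φ + length Φ ≡ suc w'
    |Φ|+|Φ|≡w = trans (cong (length Φ +_) (sym (length-map _⁻¹ Φ))) (trans (sym (length-++ Φ)) |U|≡w)

  outsideSupply : ∀ λ' N → λ' * length O ≡ 2 * N → (HasInvolutionOutside G J → 2 ∣ λ') → Supply λ' (length O) N
  outsideSupply λ' N λw≡2N involution⇒even with length O in |O|≡w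
  ... | zero = subst (Supply λ' 0) (sym N≡0) (emptySupply λ' |O|≡w)
    where
    N≡0 : N ≡ 0
    N≡0 = *-cancelˡ-≡ N 0 2 (trans (sym λw≡2N) (*-zeroʳ λ'))
  ... | suc w' with λ' % 2 | m%n<n λ' 2 | m≡m%n+[m/n]*n λ' 2
  ...   | 0 | _ | λ'≡0+q*2 =
    subst₂ (λ l N → Supply l (suc w') N) (sym λ'≡0+q*2) (sym N≡) (evenSupply |O|≡w q)
    where
    q : ℕ
    q = λ' / 2
    N≡ : N ≡ q * suc w' + 0
    N≡ = *-cancelˡ-≡ N _ 2 (trans (sym λw≡2N) (trans (cong (_* suc w') λ'≡0+q*2) (arith q (suc w'))))
      where
      arith : ∀ q w → (0 + q * 2) * w ≡ 2 * (q * w + 0)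
      arith = solve-∀
  ...   | 1 | _ | λ'≡1+q*2 =
    let c , c+c≡w , supplies = oddSupply noInvolution |O|≡w
    in subst₂ (λ l N → Supply l (suc w') N) (sym λ'≡1+q*2) (sym (N≡ c c+c≡w)) (supplies q)
    where
    q : ℕ
    q = λ' / 2
    noInvolution : ¬ HasInvolutionOutside G J
    noInvolution involution = 0≢1+n (trans
      (sym (n∣m⇒m%n≡0 (1 + q * 2) 2 (subst (2 ∣_) λ'≡1+q*2 (involution⇒even involution))))
      ([m+kn]%n≡m%n 1 q 2))
    N≡ : ∀ c → c + c ≡ suc w' → N ≡ q * suc w' + c
    N≡ c c+c≡w = *-cancelˡ-≡ N _ 2 (begin
      2 * N                  ≡⟨ λw≡2N ⟨
      λ' * suc w'            ≡⟨ cong₂ _*_ λ'≡1+q*2 (sym c+c≡w) ⟩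
      (1 + q * 2) * (c + c)  ≡⟨ arith q c ⟩
      2 * (q * (c + c) + c)  ≡⟨ cong (λ w → 2 * (q * w + c)) c+c≡w ⟩
      2 * (q * suc w' + c)   ∎)
      where
      open ≡-Reasoning
      arith : ∀ q c → (1 + q * 2) * (c + c) ≡ 2 * (q * (c + c) + c)
      arith = solve-∀
  ...   | suc (suc _) | s≤s (s≤s ()) | _

-- Assembling the array

module _ (G : PGroup) {v : ℕ} (e : PGroup.Carrier G ↔ Fin v) (J : PGroup.Carrier G → Bool) where
  open PGroup G

  filling⇒NH : ∀ λ' {m n h k} → 1 ≤ h → 1 ≤ k → (B U : Cells m n) →
    (∀ i → rowCount B i ≡ h) → (∀ j → colCount B j ≡ k) → (∀ i j → U i j ≡ B i j) →
    ∀ {S F} → Filling G U S F → withInverses G S ↭ concat (replicate λ' (outsideList G e J)) →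
    IsNH G e J λ' m n h k F
  filling⇒NH λ' {m} {n} h≥1 k≥1 B U rowB colB U≗B {F = F} filled S± =
      (λ i → trans (sum-map-cong (allFin n) (λ j → cong b2n (skel≗B i j))) (rowB i))
    , (λ j → trans (sum-map-cong (allFin m) (λ i → cong b2n (skel≗B i j))) (colB j))
    , ↭-trans (concatMap⁺ (λ x → x ∷ x ⁻¹ ∷ []) entries↭) S±
    , (λ i → rowSum≢ε i (let j , Bij = count≥1⇒∃ (B i) (subst (1 ≤_) (sym (rowB i)) h≥1) in
                         j , trans (U≗B i j) Bij))
    , (λ j → colSum≢ε j (let i , Bij = count≥1⇒∃ (λ i → B i j) (subst (1 ≤_) (sym (colB j)) k≥1) in
                         i , trans (U≗B i j) Bij))
    where
    open Filling filled
    skel≗B : ∀ i j → skel F i j ≡ B i j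
    skel≗B i j = trans (skel≗ i j) (U≗B i j)

t+w≡v⇒λw≡x : ∀ λ' t w v x → t + w ≡ v → λ' * v ≡ x + λ' * t → λ' * w ≡ x
t+w≡v⇒λw≡x λ' t w v x t+w≡v λv≡x+λt = +-cancelʳ-≡ (λ' * t) (λ' * w) x (begin
  λ' * w + λ' * t  ≡⟨ +-comm (λ' * w) (λ' * t) ⟩
  λ' * t + λ' * w  ≡⟨ *-distribˡ-+ λ' t w ⟨
  λ' * (t + w)     ≡⟨ cong (λ' *_) t+w≡v ⟩
  λ' * v           ≡⟨ λv≡x+λt ⟩
  x + λ' * t       ∎)
  where open ≡-Reasoning

theorem4p4 : (m n h k : ℕ) → 1 ≤ h → 1 ≤ k →
    (B : Cells m n) →
    (∀ i → rowCount B i ≡ h) → (∀ j → colCount B j ≡ k) →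
    (G : PGroup) → (v : ℕ) → (e : PGroup.Carrier G ↔ Fin v) →
    (J : PGroup.Carrier G → Bool) → IsSubgroup G J →
    (t : ℕ) → Σ (PGroup.Carrier G) (λ x → J x ≡ true) ↔ Fin t →
    (λ' : ℕ) → 1 ≤ λ' →
    n * k ≡ m * h →
    λ' * v ≡ 2 * n * k + λ' * t →
    t ∣ v →
    (HasInvolutionOutside G J → 2 ∣ λ') →
    (ℓ : ℕ) → (T : Fin ℓ → Cells m n) →
    (∀ i j → B i j ≡ true → ∃[ r ] T r i j ≡ true) →
    (∀ r i j → T r i j ≡ true → B i j ≡ true) →
    (∀ r r' i j → T r i j ≡ true → T r' i j ≡ true → r ≡ r') →
    (∀ r → NiceTile (T r)) →
    (∀ r → size (T r) ≤ v ∸ t) →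
    ∃[ F ] IsNH G e J λ' m n h k F
theorem4p4 m n h k h≥1 k≥1 B rowB colB G v e J J-subgroup t eJ λ' _ nk≡mh λv≡2nk+λt _
           involution⇒even ℓ T cover inB disj nice small =
  proj₁ filled , filling⇒NH G e J λ' h≥1 k≥1 B (⋃ T) rowB colB ⋃T≗B (proj₂ filled)
                   (subst (λ N → withInverses G (window supply 0 N) ↭ _) (sym totalSize≡nk) withInverses-prefix)
  where
  open Outside G e J J-subgroup
  ⋃T≗B : ∀ i j → ⋃ T i j ≡ B i j
  ⋃T≗B = ⋃≗ T B cover inB
  λ|O|≡2nk : λ' * length O ≡ 2 * (n * k)
  λ|O|≡2nk = trans (t+w≡v⇒λw≡x λ' t (length O) v _ (t+|O|≡v eJ) λv≡2nk+λt) (*-assoc 2 n k)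
  open Supply (outsideSupply λ' (n * k) λ|O|≡2nk involution⇒even)
  totalSize≡nk : totalSize T ≡ n * k
  totalSize≡nk = trans (totalSize≡size-⋃ T disj)
    (trans (size-cong (⋃ T) B ⋃T≗B) (trans (size≡rows*h B h rowB) (sym nk≡mh)))
  tilesFit : ∀ r → size (T r) ≤ length O
  tilesFit r = subst (size (T r) ≤_) (trans (cong (_∸ t) (sym (t+|O|≡v eJ))) (m+n∸m≡n t (length O))) (small r)
  filled : ∃[ F ] Filling G (⋃ T) (window supply 0 (totalSize T)) F
  filled = fillTiles G supply (length O) window-unique T nice disj tilesFit 0
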